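{- Let $d\in\mathbb{N}_{>0}$. Every $d$-regular graph $G$ satisfies $\text{ffn}(G)\ge d+1$, and this bound is tight (there is a $d$-regular graph with firefighter number exactly $d+1$). For $d\in\{1,2\}$, every $d$-regular graph $G$ satisfies $\text{ffn}(G)=d+1$. For every $d\ge3$ and every $k\in\mathbb{N}$ there exists a $d$-regular graph $G$ with $\text{ffn}(G)>k$.
   Context: All graphs are finite, simple and undirected. For a graph $G=(V,E)$ and $W\subseteq V$, $N(W)$ is the set of nodes in $V\setminus W$ adjacent to at least one node of $W$. For $m\in\mathbb{N}_{>0}$, an $m$-strategy of length $T$ is a sequence $(F_1,\dots,F_T)$ of subsets of $V$ with $|F_i|\le m$. Its burning sets are $B_0=V$ and $B_t=(B_{t-1}\setminus F_t)\cup N(B_{t-1}\setminus F_t)$ for $t\ge1$, where $F_t=\emptyset$ for $t>T$. The strategy is winning if $B_T=\emptyset$. The firefighter number $\text{ffn}(G)$ is the smallest $m$ for which a winning $m$-strategy for $G$ exists. -}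

module Defs where

open import Data.Nat using (ℕ; zero; suc; _≤_; _<_)
open import Data.Bool using (Bool; true; false; _∧_; _∨_; not)
open import Data.Fin using (Fin)
open import Data.Fin.Subset using (Subset; ∣_∣; ⊤; ⊥; _∪_; _─_)
open import Data.Vec using (Vec; tabulate; lookup; foldr)
open import Data.List using (List; []; _∷_)
open import Data.List.Relation.Unary.All using (All)
open import Data.Product using (Σ; _×_)
open import Relation.Binary.PropositionalEquality using (_≡_)
open import Relation.Nullary using (¬_)

record Graph (n : ℕ) : Set where
  field
    adj    : Fin n → Fin n → Bool
    sym    : ∀ i j → adj i j ≡ adj j i
    irrefl : ∀ i → adj i i ≡ false
open Graph public

nbhd : ∀ {n} → Graph n → Fin n → Subset n
nbhd G v = tabulate (adj G v)

Regular : ∀ {n} → ℕ → Graph n → Set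
Regular d G = ∀ v → ∣ nbhd G v ∣ ≡ d

anyFin : ∀ {n} → (Fin n → Bool) → Bool
anyFin {n} p = foldr (λ _ → Bool) _∨_ false (tabulate p)

N : ∀ {n} → Graph n → Subset n → Subset n
N G W = tabulate (λ i → not (lookup W i) ∧ anyFin (λ j → lookup W j ∧ adj G i j))

step : ∀ {n} → Graph n → Subset n → Subset n → Subset n
step G F B = (B ─ F) ∪ N G (B ─ F)

burnFrom : ∀ {n} → Graph n → List (Subset n) → Subset n → Subset n
burnFrom G []       B = B
burnFrom G (F ∷ Fs) B = burnFrom G Fs (step G F B)

burn : ∀ {n} → Graph n → List (Subset n) → Subset n
burn G s = burnFrom G s ⊤

IsStrategy : ∀ {n} → ℕ → List (Subset n) → Set
IsStrategy m s = All (λ F → ∣ F ∣ ≤ m) s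

Winnable : ∀ {n} → Graph n → ℕ → Set
Winnable G m = Σ (List _) (λ s → IsStrategy m s × burn G s ≡ ⊥)

IsFfn : ∀ {n} → Graph n → ℕ → Set
IsFfn G m = (1 ≤ m) × Winnable G m × (∀ m′ → 1 ≤ m′ → m′ < m → ¬ Winnable G m′)

-- If a vertex and all its neighbours burn and fewer firefighters than the size of this closed
-- neighbourhood are placed, some unprotected vertex keeps burning and its closed neighbourhood burns
-- in the next round; so d firefighters never save a graph of minimum degree d, and K_{d+1}, saved by
-- protecting everything at once, shows the bound is attained.
-- On a graph of maximum degree d ≤ 2, d + 1 firefighters keep the burning boundary ∂ B = N (∁ B) of
-- size at most d: they protect ∂ B together with one burning vertex a, chosen on the boundary when
-- possible, and its burning neighbours. The fire then cannot spread, a goes out, and the new boundary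
-- lies in F − a; the count |F| ≤ d + 1 holds precisely because d ≤ 2.
-- For d ≥ 3 take a torus of side 2k + 3 whose vertices are blown up into cliques on d − 1 layers,
-- joined along rows in layer 0 and along columns in the other layers. For the unburnt set U, the
-- quantity |U| + |N U| grows by at most the number of firefighters in each round, whereas in this
-- graph every U with more than K k vertices (K the size of a row) has |U| + |N U| > K k + k, by
-- counting the rows and columns that meet both U and its complement. Hence k firefighters never save
-- more than K k vertices.
-- The firefighter number exists because winnability is decidable: removing repeated burning sets
-- from a winning play bounds its length by 2 ^ n.

module Submission where

open import Defs hiding (sym)
open import Data.Nat using (ℕ; zero; suc; _+_; _*_; _∸_; _^_; _≤_; _<_; z≤n; s≤s; _≤?_; _<?_)
open import Data.Nat.Properties
open import Data.Bool using (Bool; true; false; _∧_; _∨_; not)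
import Data.Bool
open import Data.Bool.Properties
  using (∧-conicalˡ; ∧-conicalʳ; ∧-zeroʳ; ∧-assoc; ∨-zeroʳ; ∨-comm; not-injective; ¬-not)
open import Data.Fin
  using (Fin; zero; suc; toℕ; fromℕ; inject₁; punchIn; _↑ˡ_; _↑ʳ_; combine; remQuot; funToFin; finToFun)
open import Data.Fin.Properties
  using ( punchInᵢ≢i; any?; all?; ¬∀⟶∃¬; finToFun-funToFin; 2↔Bool; injective⇒≤
        ; remQuot-combine; combine-remQuot; fromℕ≢inject₁; inject₁-injective; toℕ-inject₁; toℕ-fromℕ)
open import Data.Fin.Subset using (Subset; ∣_∣; ⊤; ⊥; ⁅_⁆; _∪_; _∩_; _─_; ∁; _∈_; _∉_; _⊆_; Empty; Nonempty)
open import Data.Fin.Subset.Properties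
  using ( Empty-unique; ∣⊥∣≡0; ∣⊤∣≡n; ∣∁p∣≡n∸∣p∣; ∣p∣≤n; p⊂q⇒∣p∣<∣q∣; _∈?_; nonempty?; ∈⊤; ∉⊥
        ; x∈p∪q⁺; x∈p∪q⁻; x∈p∧x∉q⇒x∈p─q; drop-there; anySubset?
        ; p⊆q⇒∣p∣≤∣q∣; p⊆p∪q; q⊆p∪q; p∩q⊆p; p∩q⊆q; x∈p∩q⁺; ∣⁅x⁆∣≡1; x∈⁅x⁆
        ; x∈p⇒x∉∁p; x∈∁p⇒x∉p; x∉p⇒x∈∁p; x∉∁p⇒x∈p)
open import Data.Vec using ([]; _∷_; tabulate; lookup)
import Data.Vec as Vec
open import Data.Vec.Properties
  using ( lookup∘tabulate; lookup-map; tabulate∘lookup; tabulate-cong; lookup-zipWith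
        ; []=⇒lookup; lookup⇒[]=; ≡-dec)
open import Data.Product using (Σ; _×_; _,_; _,′_; proj₁; proj₂; ∃; map)
open import Data.Sum using (_⊎_; inj₁; inj₂; [_,_])
open import Data.List using (List; []; _∷_; length)
import Data.List as List
open import Data.List.Relation.Unary.Any using (here; there)
open import Data.List.Relation.Unary.All.Properties using (¬Any⇒All¬)
open import Data.List.Membership.Propositional using () renaming (_∈_ to _∈ₗ_)
open import Data.List.Membership.Propositional.Properties using (∈-lookup)
import Data.List.Membership.DecPropositional as DecMembership
open import Data.List.Relation.Unary.Unique.Propositional using (Unique; []; _∷_)
open import Data.List.Relation.Unary.All using (All; []; _∷_)
import Data.List.Relation.Unary.All as All
open import Data.Empty using (⊥-elim)
open import Function using (_∘_; id; _on_; case_of_)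
open import Induction.WellFounded using (Acc; acc)
open import Data.Nat.Induction using (<-wellFounded)
import Relation.Binary.Construct.On as On
open import Relation.Nullary using (¬_; Dec; yes; no)
open import Relation.Nullary.Decidable
  using (_⊎-dec_; _×-dec_; ¬?; does; dec-true; dec-false; decidable-stable)
open import Function.Bundles using (Inverse)
open import Relation.Binary.Definitions using (DecidableEquality)
open import Relation.Binary.PropositionalEquality
  using (_≡_; _≢_; refl; sym; trans; cong; cong₂; subst; module ≡-Reasoning)
open import Data.Nat.Solver using (module +-*-Solver)
open import Algebra.Properties.Semiring.Sum +-*-semiring
  using (sum; sum-syntax; sum-cong-≗; sum-remove; sum-replicate-zero; ∑-distrib-+; ∑-comm; *-distribˡ-sum)

-- Counting and subsets

𝟙 : Bool → ℕ
𝟙 true  = 1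
𝟙 false = 0

count : ∀ {n} → (Fin n → Bool) → ℕ
count {n} p = ∑[ i < n ] 𝟙 (p i)

∑-mono-≤ : ∀ {n} {f g : Fin n → ℕ} → (∀ i → f i ≤ g i) → sum f ≤ sum g
∑-mono-≤ {zero}  f≤g = z≤n
∑-mono-≤ {suc n} f≤g = +-mono-≤ (f≤g zero) (∑-mono-≤ (f≤g ∘ suc))

∑-const : ∀ n c → ∑[ i < n ] c ≡ n * c
∑-const zero    c = refl
∑-const (suc n) c = cong (c +_) (∑-const n c)

∑-single : ∀ {n} (f : Fin n → ℕ) x → (∀ i → i ≢ x → f i ≡ 0) → sum f ≡ f x
∑-single {suc n} f x f≡0 = begin
  sum f                                   ≡⟨ sum-remove {i = x} f ⟩
  f x + ∑[ j < n ] f (punchIn x j)        ≡⟨ cong (f x +_) (sum-cong-≗ (λ j → f≡0 _ (punchInᵢ≢i x j))) ⟩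
  f x + ∑[ j < n ] 0                      ≡⟨ cong (f x +_) (sum-replicate-zero n) ⟩
  f x + 0                                 ≡⟨ +-identityʳ (f x) ⟩
  f x                                     ∎
  where open ≡-Reasoning

∑-↑ : ∀ m n (f : Fin (m + n) → ℕ) → sum f ≡ ∑[ i < m ] f (i ↑ˡ n) + ∑[ j < n ] f (m ↑ʳ j)
∑-↑ zero    n f = refl
∑-↑ (suc m) n f = trans (cong (f zero +_) (∑-↑ m n (f ∘ suc))) (sym (+-assoc (f zero) _ _))

∑-combine : ∀ m n (f : Fin (m * n) → ℕ) → sum f ≡ ∑[ i < m ] ∑[ j < n ] f (combine i j)
∑-combine zero    n f = refl
∑-combine (suc m) n f =
  trans (∑-↑ n (m * n) f) (cong (∑[ j < n ] f (j ↑ˡ m * n) +_) (∑-combine m n (f ∘ (n ↑ʳ_))))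

combine-elim : ∀ m n {P : Fin (m * n) → Set} → (∀ i a → P (combine i a)) → ∀ y → P y
combine-elim m n {P} P-combine y =
  subst P (combine-remQuot {m} n y) (P-combine (proj₁ (remQuot {m} n y)) (proj₂ (remQuot {m} n y)))

count-cong : ∀ {n} {p q : Fin n → Bool} → (∀ i → p i ≡ q i) → count p ≡ count q
count-cong p≗q = sum-cong-≗ (cong 𝟙 ∘ p≗q)

count≤n : ∀ {n} (p : Fin n → Bool) → count p ≤ n
count≤n {n} p = begin
  count p          ≤⟨ ∑-mono-≤ (λ i → 𝟙≤1 (p i)) ⟩
  ∑[ i < n ] 1     ≡⟨ ∑-const n 1 ⟩
  n * 1            ≡⟨ *-identityʳ n ⟩
  n                ∎
  where
  open ≤-Reasoning
  𝟙≤1 : ∀ b → 𝟙 b ≤ 1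
  𝟙≤1 true  = ≤-refl
  𝟙≤1 false = z≤n

≤-∑ : ∀ {n} (f : Fin n → ℕ) x → f x ≤ sum f
≤-∑ {suc n} f x = ≤-trans (m≤m+n (f x) _) (≤-reflexive (sym (sum-remove {i = x} f)))

count-pos : ∀ {n} (p : Fin n → Bool) {x} → p x ≡ true → 0 < count p
count-pos p {x} px≡true = ≤-trans (≤-reflexive (cong 𝟙 (sym px≡true))) (≤-∑ (𝟙 ∘ p) x)

count-single : ∀ {n} (p : Fin n → Bool) x → p x ≡ true → (∀ i → i ≢ x → p i ≡ false) → count p ≡ 1
count-single p x px≡true p≡false with p x | ∑-single (𝟙 ∘ p) x (λ i i≢x → cong 𝟙 (p≡false i i≢x))
... | true | count≡ = count≡

𝟙-∨+𝟙-∧ : ∀ a b → 𝟙 (a ∨ b) + 𝟙 (a ∧ b) ≡ 𝟙 a + 𝟙 b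
𝟙-∨+𝟙-∧ true  true  = refl
𝟙-∨+𝟙-∧ true  false = refl
𝟙-∨+𝟙-∧ false b     = +-identityʳ (𝟙 b)

𝟙-∨-disjoint : ∀ a b → a ∧ b ≡ false → 𝟙 (a ∨ b) ≡ 𝟙 a + 𝟙 b
𝟙-∨-disjoint a b a∧b≡false = begin
  𝟙 (a ∨ b)                ≡⟨ +-identityʳ _ ⟨
  𝟙 (a ∨ b) + 𝟙 false      ≡⟨ cong (λ c → 𝟙 (a ∨ b) + 𝟙 c) a∧b≡false ⟨
  𝟙 (a ∨ b) + 𝟙 (a ∧ b)    ≡⟨ 𝟙-∨+𝟙-∧ a b ⟩
  𝟙 a + 𝟙 b                ∎
  where open ≡-Reasoning

count-∨+count-∧ : ∀ {n} (p q : Fin n → Bool) →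
  count (λ i → p i ∨ q i) + count (λ i → p i ∧ q i) ≡ count p + count q
count-∨+count-∧ p q = begin
  count (λ i → p i ∨ q i) + count (λ i → p i ∧ q i)
    ≡⟨ ∑-distrib-+ (λ i → 𝟙 (p i ∨ q i)) (λ i → 𝟙 (p i ∧ q i)) ⟨
  sum (λ i → 𝟙 (p i ∨ q i) + 𝟙 (p i ∧ q i))
    ≡⟨ sum-cong-≗ (λ i → 𝟙-∨+𝟙-∧ (p i) (q i)) ⟩
  sum (λ i → 𝟙 (p i) + 𝟙 (q i))
    ≡⟨ ∑-distrib-+ (𝟙 ∘ p) (𝟙 ∘ q) ⟩
  count p + count q
    ∎
  where open ≡-Reasoning

count-none : ∀ {n} (p : Fin n → Bool) → (∀ i → p i ≡ false) → count p ≡ 0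
count-none {n} p p≡false = trans (sum-cong-≗ (cong 𝟙 ∘ p≡false)) (sum-replicate-zero n)

count-∨-disjoint : ∀ {n} (p q : Fin n → Bool) → (∀ i → p i ∧ q i ≡ false) →
  count (λ i → p i ∨ q i) ≡ count p + count q
count-∨-disjoint p q disjoint =
  trans (sum-cong-≗ (λ i → 𝟙-∨-disjoint (p i) (q i) (disjoint i))) (∑-distrib-+ (𝟙 ∘ p) (𝟙 ∘ q))

count+count-not : ∀ {n} (p : Fin n → Bool) → count p + count (not ∘ p) ≡ n
count+count-not {n} p = begin
  count p + count (not ∘ p)               ≡⟨ ∑-distrib-+ (𝟙 ∘ p) (𝟙 ∘ not ∘ p) ⟨
  sum (λ i → 𝟙 (p i) + 𝟙 (not (p i)))     ≡⟨ sum-cong-≗ (λ i → 𝟙+𝟙-not (p i)) ⟩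
  ∑[ i < n ] 1                            ≡⟨ ∑-const n 1 ⟩
  n * 1                                   ≡⟨ *-identityʳ n ⟩
  n                                       ∎
  where
  open ≡-Reasoning
  𝟙+𝟙-not : ∀ a → 𝟙 a + 𝟙 (not a) ≡ 1
  𝟙+𝟙-not true  = refl
  𝟙+𝟙-not false = refl

∑-count-≤ : ∀ {N K} (p q : Fin N → Fin K → Bool) →
  (∀ j → ∃ (λ y → p j y ≡ true) → ∃ λ y → q j y ≡ true) →
  ∑[ j < N ] count (p j) ≤ K * ∑[ j < N ] count (q j)
∑-count-≤ {N} {K} p q p⇒q = begin
  ∑[ j < N ] count (p j)          ≤⟨ ∑-mono-≤ blockwise ⟩
  ∑[ j < N ] (K * count (q j))    ≡⟨ *-distribˡ-sum K (count ∘ q) ⟨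
  K * ∑[ j < N ] count (q j)      ∎
  where
  open ≤-Reasoning
  blockwise : ∀ j → count (p j) ≤ K * count (q j)
  blockwise j with any? (λ y → p j y Data.Bool.≟ true)
  ... | yes p-some = let (_ , qy≡true) = p⇒q j p-some in begin
    count (p j)      ≤⟨ count≤n (p j) ⟩
    K                ≡⟨ *-identityʳ K ⟨
    K * 1            ≤⟨ *-monoʳ-≤ K (count-pos (q j) qy≡true) ⟩
    K * count (q j)  ∎
  ... | no  p-none = begin
    count (p j)      ≡⟨ count-none (p j) (λ y → ¬-not λ py≡true → p-none (y , py≡true)) ⟩
    0                ≤⟨ z≤n ⟩
    K * count (q j)  ∎

∣p∣≡count : ∀ {n} (p : Subset n) → ∣ p ∣ ≡ count (lookup p)
∣p∣≡count []          = refl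
∣p∣≡count (true  ∷ p) = cong suc (∣p∣≡count p)
∣p∣≡count (false ∷ p) = ∣p∣≡count p

∣tabulate∣≡count : ∀ {n} (p : Fin n → Bool) → ∣ tabulate p ∣ ≡ count p
∣tabulate∣≡count p = trans (∣p∣≡count (tabulate p)) (count-cong (lookup∘tabulate p))

∣p∪q∣+∣p∩q∣≡∣p∣+∣q∣ : ∀ {n} (p q : Subset n) → ∣ p ∪ q ∣ + ∣ p ∩ q ∣ ≡ ∣ p ∣ + ∣ q ∣
∣p∪q∣+∣p∩q∣≡∣p∣+∣q∣ p q = begin
  ∣ p ∪ q ∣ + ∣ p ∩ q ∣
    ≡⟨ cong₂ _+_ (trans (∣p∣≡count (p ∪ q)) (count-cong (λ i → lookup-zipWith _∨_ i p q)))
                 (trans (∣p∣≡count (p ∩ q)) (count-cong (λ i → lookup-zipWith _∧_ i p q))) ⟩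
  count (λ i → lookup p i ∨ lookup q i) + count (λ i → lookup p i ∧ lookup q i)
    ≡⟨ count-∨+count-∧ (lookup p) (lookup q) ⟩
  count (lookup p) + count (lookup q)
    ≡⟨ cong₂ _+_ (∣p∣≡count p) (∣p∣≡count q) ⟨
  ∣ p ∣ + ∣ q ∣ ∎
  where open ≡-Reasoning

∣p∪q∣≤∣p∣+∣q∣ : ∀ {n} (p q : Subset n) → ∣ p ∪ q ∣ ≤ ∣ p ∣ + ∣ q ∣
∣p∪q∣≤∣p∣+∣q∣ p q = ≤-trans (m≤m+n ∣ p ∪ q ∣ ∣ p ∩ q ∣) (≤-reflexive (∣p∪q∣+∣p∩q∣≡∣p∣+∣q∣ p q))

∣p∪q∣≡∣p∣+∣q∣ : ∀ {n} (p q : Subset n) → Empty (p ∩ q) → ∣ p ∪ q ∣ ≡ ∣ p ∣ + ∣ q ∣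
∣p∪q∣≡∣p∣+∣q∣ {n} p q p∩q-empty = begin
  ∣ p ∪ q ∣              ≡⟨ +-identityʳ _ ⟨
  ∣ p ∪ q ∣ + 0          ≡⟨ cong (∣ p ∪ q ∣ +_) (∣⊥∣≡0 n) ⟨
  ∣ p ∪ q ∣ + ∣ ⊥ {n} ∣  ≡⟨ cong (λ r → ∣ p ∪ q ∣ + ∣ r ∣) (Empty-unique {p = p ∩ q} p∩q-empty) ⟨
  ∣ p ∪ q ∣ + ∣ p ∩ q ∣  ≡⟨ ∣p∪q∣+∣p∩q∣≡∣p∣+∣q∣ p q ⟩
  ∣ p ∣ + ∣ q ∣          ∎
  where open ≡-Reasoning

∣p∣+∣∁p∣≡n : ∀ {n} (p : Subset n) → ∣ p ∣ + ∣ ∁ p ∣ ≡ n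
∣p∣+∣∁p∣≡n {n} p = trans (cong (∣ p ∣ +_) (∣∁p∣≡n∸∣p∣ p)) (m+[n∸m]≡n (∣p∣≤n p))

lookup⇒∈ : ∀ {n} {x : Fin n} {p : Subset n} → lookup p x ≡ true → x ∈ p
lookup⇒∈ {x = x} {p} = lookup⇒[]= x p

∉⇒lookup : ∀ {n} {x : Fin n} {p : Subset n} → x ∉ p → lookup p x ≡ false
∉⇒lookup {x = x} {p} x∉p with lookup p x in eq
... | true  with () ← x∉p (lookup⇒∈ eq)
... | false = refl

lookup⇒∉ : ∀ {n} {x : Fin n} {p : Subset n} → lookup p x ≡ false → x ∉ p
lookup⇒∉ px≡false x∈p with () ← trans (sym ([]=⇒lookup x∈p)) px≡false

∈tabulate⁺ : ∀ {n} {f : Fin n → Bool} {x} → f x ≡ true → x ∈ tabulate f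
∈tabulate⁺ {f = f} {x} fx≡true = lookup⇒∈ (trans (lookup∘tabulate f x) fx≡true)

∈tabulate⁻ : ∀ {n} {f : Fin n → Bool} {x} → x ∈ tabulate f → f x ≡ true
∈tabulate⁻ {f = f} {x} x∈ = trans (sym (lookup∘tabulate f x)) ([]=⇒lookup x∈)

x∈p─q⁻ : ∀ {n} {x : Fin n} (p q : Subset n) → x ∈ p ─ q → x ∈ p × x ∉ q
x∈p─q⁻            (true ∷ p)  (false ∷ q) Vec.here        = Vec.here , λ ()
x∈p─q⁻ {x = zero} (false ∷ p) (true ∷ q)  ()
x∈p─q⁻ {x = zero} (false ∷ p) (false ∷ q) ()
x∈p─q⁻            (_ ∷ p)     (_ ∷ q)     (Vec.there x∈) with x∈p─q⁻ p q x∈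
... | x∈p , x∉q = Vec.there x∈p , x∉q ∘ drop-there

anyFin⁺ : ∀ {n} (p : Fin n → Bool) {j} → p j ≡ true → anyFin p ≡ true
anyFin⁺ p {zero}  pj≡true rewrite pj≡true = refl
anyFin⁺ p {suc j} pj≡true with p zero
... | true  = refl
... | false = anyFin⁺ (p ∘ suc) pj≡true

anyFin⁻ : ∀ {n} (p : Fin n → Bool) → anyFin p ≡ true → ∃ λ j → p j ≡ true
anyFin⁻ {suc n} p any≡true with p zero in p0≡
... | true  = zero , p0≡
... | false with anyFin⁻ (p ∘ suc) any≡true
...   | j , pj≡true = suc j , pj≡true

-- Fire spreading

module _ {n} (G : Graph n) where

  ∈nbhd⁺ : ∀ {v w} → adj G v w ≡ true → w ∈ nbhd G v
  ∈nbhd⁺ = ∈tabulate⁺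

  ∈nbhd⁻ : ∀ {v w} → w ∈ nbhd G v → adj G v w ≡ true
  ∈nbhd⁻ = ∈tabulate⁻

  nbhd-sym : ∀ {v w} → w ∈ nbhd G v → v ∈ nbhd G w
  nbhd-sym {v} {w} w∈ = ∈nbhd⁺ (trans (Graph.sym G w v) (∈nbhd⁻ w∈))

  ∉nbhd-self : ∀ v → v ∉ nbhd G v
  ∉nbhd-self v v∈ with () ← trans (sym (∈nbhd⁻ v∈)) (irrefl G v)

  ∈N⁺ : ∀ {W v w} → v ∉ W → w ∈ W → w ∈ nbhd G v → v ∈ N G W
  ∈N⁺ {W} {v} {w} v∉W w∈W w∈nbhd = ∈tabulate⁺ (begin
    not (lookup W v) ∧ anyFin (λ j → lookup W j ∧ adj G v j)
      ≡⟨ cong₂ (λ a b → not a ∧ b) (∉⇒lookup v∉W)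
               (anyFin⁺ (λ j → lookup W j ∧ adj G v j) (cong₂ _∧_ ([]=⇒lookup w∈W) (∈nbhd⁻ w∈nbhd))) ⟩
    true ∎)
    where open ≡-Reasoning

  ∈N⁻ : ∀ {W v} → v ∈ N G W → v ∉ W × ∃ λ w → w ∈ W × w ∈ nbhd G v
  ∈N⁻ {W} {v} v∈N with anyFin⁻ _ (∧-conicalʳ _ _ (∈tabulate⁻ v∈N))
  ... | w , w∈W∧adj = lookup⇒∉ (not-injective (∧-conicalˡ _ _ (∈tabulate⁻ v∈N)))
                    , w , lookup⇒∈ (∧-conicalˡ _ _ w∈W∧adj) , ∈nbhd⁺ (∧-conicalʳ _ _ w∈W∧adj)

  ∈step⁺ : ∀ {F B v} → v ∈ B ─ F → v ∈ step G F B
  ∈step⁺ v∈X = x∈p∪q⁺ (inj₁ v∈X)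

  ∈step-spread : ∀ {F B v w} → w ∈ B ─ F → w ∈ nbhd G v → v ∈ step G F B
  ∈step-spread {F} {B} {v} w∈X w∈nbhd with v ∈? B ─ F
  ... | yes v∈X = ∈step⁺ v∈X
  ... | no  v∉X = x∈p∪q⁺ (inj₂ (∈N⁺ v∉X w∈X w∈nbhd))

  ∈step⁻ : ∀ {F B v} → v ∈ step G F B → v ∈ B ─ F ⊎ ∃ λ w → w ∈ B ─ F × w ∈ nbhd G v
  ∈step⁻ {F} {B} v∈step with x∈p∪q⁻ (B ─ F) _ v∈step
  ... | inj₁ v∈X = inj₁ v∈X
  ... | inj₂ v∈N = inj₂ (proj₂ (∈N⁻ v∈N))

  step-≡⊥ : ∀ {F B} → Empty (B ─ F) → step G F B ≡ ⊥
  step-≡⊥ X-empty = Empty-unique λ where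
    (v , v∈step) → [ (λ v∈X → X-empty (v , v∈X)) , (λ (w , w∈X , _) → X-empty (w , w∈X)) ] (∈step⁻ v∈step)

WinnableFrom : ∀ {n} → Graph n → ℕ → Subset n → Set
WinnableFrom {n} G m B = Σ (List (Subset n)) (λ s → IsStrategy m s × burnFrom G s B ≡ ⊥)

winnable-mono : ∀ {n} (G : Graph n) {m m′} → m ≤ m′ → Winnable G m → Winnable G m′
winnable-mono G m≤m′ (s , valid , won) = s , All.map (λ ∣F∣≤m → ≤-trans ∣F∣≤m m≤m′) valid , won

winnable-by-all : ∀ {n} (G : Graph n) → Winnable G n
winnable-by-all {n} G =
  ⊤ ∷ [] , ≤-reflexive (∣⊤∣≡n n) ∷ [] , step-≡⊥ G (λ (v , v∈⊤─⊤) → proj₂ (x∈p─q⁻ ⊤ ⊤ v∈⊤─⊤) ∈⊤)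

descent : ∀ {n} (G : Graph n) {m} (P : Subset n → Set) →
  (∀ {B} → P B → Nonempty B → ∃ λ F → ∣ F ∣ ≤ m × P (step G F B) × ∣ step G F B ∣ < ∣ B ∣) →
  ∀ {B} → P B → WinnableFrom G m B
descent {n} G {m} P round {B} = go B (On.wellFounded ∣_∣ <-wellFounded B)
  where
  go : ∀ B → Acc (_<_ on ∣_∣) B → P B → WinnableFrom G m B
  go B (acc smaller) PB with nonempty? B
  ... | no  empty = [] , [] , Empty-unique empty
  ... | yes nonempty with round PB nonempty
  ...   | F , ∣F∣≤m , PB′ , ∣B′∣<∣B∣ with go (step G F B) (smaller ∣B′∣<∣B∣) PB′
  ...     | s , valid , won = F ∷ s , ∣F∣≤m ∷ valid , won

-- Lower bound

module _ {n} (G : Graph n) {m} (m≤deg : ∀ v → m ≤ ∣ nbhd G v ∣) where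

  ContainsClosedNbhd : Subset n → Set
  ContainsClosedNbhd B = ∃ λ v → v ∈ B × nbhd G v ⊆ B

  containsClosedNbhd-step : ∀ {F B} → ∣ F ∣ ≤ m → ContainsClosedNbhd B → ContainsClosedNbhd (step G F B)
  containsClosedNbhd-step {F} {B} ∣F∣≤m (v , v∈B , nbhd⊆B) with nonempty? (B ─ F)
  ... | yes (x , x∈X) = x , ∈step⁺ G x∈X , λ w∈nbhd → ∈step-spread G x∈X (nbhd-sym G w∈nbhd)
  ... | no  X-empty   = ⊥-elim (<-irrefl refl (begin-strict
    m              ≤⟨ m≤deg v ⟩
    ∣ nbhd G v ∣   <⟨ p⊂q⇒∣p∣<∣q∣ ((B⊆F ∘ nbhd⊆B) , v , B⊆F v∈B , ∉nbhd-self G v) ⟩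
    ∣ F ∣          ≤⟨ ∣F∣≤m ⟩
    m              ∎))
    where
    open ≤-Reasoning
    B⊆F : B ⊆ F
    B⊆F {u} u∈B with u ∈? F
    ... | yes u∈F = u∈F
    ... | no  u∉F = ⊥-elim (X-empty (u , x∈p∧x∉q⇒x∈p─q u∈B u∉F))

  containsClosedNbhd-unwinnable : ∀ {B} → ContainsClosedNbhd B → ¬ WinnableFrom G m B
  containsClosedNbhd-unwinnable (v , v∈B , _) ([]    , []          , B≡⊥) = ∉⊥ (subst (v ∈_) B≡⊥ v∈B)
  containsClosedNbhd-unwinnable closed        (F ∷ s , ∣F∣≤m ∷ valid , won) =
    containsClosedNbhd-unwinnable (containsClosedNbhd-step ∣F∣≤m closed) (s , valid , won)

mindeg-unwinnable : ∀ {n} (G : Graph (suc n)) {m} → (∀ v → m ≤ ∣ nbhd G v ∣) → ¬ Winnable G m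
mindeg-unwinnable G m≤deg = containsClosedNbhd-unwinnable G m≤deg (zero , ∈⊤ , λ _ → ∈⊤)

-- Existence of the firefighter number

encode : ∀ {n} → Subset n → Fin (2 ^ n)
encode p = funToFin (Inverse.from 2↔Bool ∘ lookup p)

encode-injective : ∀ {n} {p q : Subset n} → encode p ≡ encode q → p ≡ q
encode-injective {p = p} {q} eq = begin
  p                        ≡⟨ tabulate∘lookup p ⟨
  tabulate (lookup p)      ≡⟨ tabulate-cong lookup-eq ⟩
  tabulate (lookup q)      ≡⟨ tabulate∘lookup q ⟩
  q                        ∎
  where
  open ≡-Reasoning
  from : Bool → Fin 2
  from = Inverse.from 2↔Bool
  from-eq : ∀ i → from (lookup p i) ≡ from (lookup q i)
  from-eq i = trans (sym (finToFun-funToFin (from ∘ lookup p) i))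
                    (trans (cong (λ c → finToFun c i) eq) (finToFun-funToFin (from ∘ lookup q) i))
  lookup-eq : ∀ i → lookup p i ≡ lookup q i
  lookup-eq i = begin
    lookup p i                             ≡⟨ Inverse.strictlyInverseˡ 2↔Bool (lookup p i) ⟨
    Inverse.to 2↔Bool (from (lookup p i))  ≡⟨ cong (Inverse.to 2↔Bool) (from-eq i) ⟩
    Inverse.to 2↔Bool (from (lookup q i))  ≡⟨ Inverse.strictlyInverseˡ 2↔Bool (lookup q i) ⟩
    lookup q i                             ∎

Unique⇒lookup-injective : ∀ {A : Set} {xs : List A} → Unique xs →
  ∀ i j → List.lookup xs i ≡ List.lookup xs j → i ≡ j
Unique⇒lookup-injective (_ ∷ _)        zero    zero    _  = refl
Unique⇒lookup-injective (x≢xs ∷ _)     zero    (suc j) eq with () ← All.lookup x≢xs (∈-lookup j) eq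
Unique⇒lookup-injective (x≢xs ∷ _)     (suc i) zero    eq with () ← All.lookup x≢xs (∈-lookup i) (sym eq)
Unique⇒lookup-injective (_ ∷ unique)   (suc i) (suc j) eq = cong suc (Unique⇒lookup-injective unique i j eq)

unique-subsets-length : ∀ {n} {ps : List (Subset n)} → Unique ps → length ps ≤ 2 ^ n
unique-subsets-length unique =
  injective⇒≤ (λ {i} {j} eq → Unique⇒lookup-injective unique i j (encode-injective eq))

module _ {n} (G : Graph n) (m : ℕ) where

  trajectory : List (Subset n) → Subset n → List (Subset n)
  trajectory []      B = B ∷ []
  trajectory (F ∷ s) B = B ∷ trajectory s (step G F B)

  length-trajectory : ∀ s B → length (trajectory s B) ≡ suc (length s)
  length-trajectory []      B = refl
  length-trajectory (F ∷ s) B = cong suc (length-trajectory s (step G F B))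

  resume : ∀ {B} s B₀ → B ∈ₗ trajectory s B₀ → ∃ λ s′ →
    (IsStrategy m s → IsStrategy m s′) × burnFrom G s′ B ≡ burnFrom G s B₀ ×
    (Unique (trajectory s B₀) → Unique (trajectory s′ B))
  resume []      B₀ (here refl) = [] , (λ valid → valid) , refl , (λ unique → unique)
  resume (F ∷ s) B₀ (here refl) = F ∷ s , (λ valid → valid) , refl , (λ unique → unique)
  resume (F ∷ s) B₀ (there B∈)  with resume s (step G F B₀) B∈
  ... | s′ , valid⇒ , same-end , unique⇒ =
    s′ , (λ { (_ ∷ valid) → valid⇒ valid }) , same-end , (λ { (_ ∷ unique) → unique⇒ unique })

  _≟ₛ_ : DecidableEquality (Subset n)
  _≟ₛ_ = ≡-dec Data.Bool._≟_

  open DecMembership _≟ₛ_ using () renaming (_∈?_ to _∈ₗ?_)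

  prune : ∀ s B → IsStrategy m s → burnFrom G s B ≡ ⊥ →
    ∃ λ s′ → IsStrategy m s′ × burnFrom G s′ B ≡ ⊥ × Unique (trajectory s′ B)
  prune []      B valid won = [] , [] , won , [] ∷ []
  prune (F ∷ s) B (∣F∣≤m ∷ valid) won with prune s (step G F B) valid won
  ... | s′ , valid′ , won′ , unique′ with B ∈ₗ? trajectory s′ (step G F B)
  ...   | no  B∉ = F ∷ s′ , ∣F∣≤m ∷ valid′ , won′ , ¬Any⇒All¬ _ B∉ ∷ unique′
  ...   | yes B∈ with resume s′ (step G F B) B∈
  ...     | s″ , valid⇒ , same-end , unique⇒ =
    s″ , valid⇒ valid′ , trans same-end won′ , unique⇒ unique′

  WinnableWithin : ℕ → Subset n → Set
  WinnableWithin zero    B = B ≡ ⊥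
  WinnableWithin (suc L) B = B ≡ ⊥ ⊎ ∃ λ F → ∣ F ∣ ≤ m × WinnableWithin L (step G F B)

  winnableWithin? : ∀ L B → Dec (WinnableWithin L B)
  winnableWithin? zero    B = B ≟ₛ ⊥
  winnableWithin? (suc L) B =
    B ≟ₛ ⊥ ⊎-dec anySubset? (λ F → (∣ F ∣ ≤? m) ×-dec winnableWithin? L (step G F B))

  within⇒winnable : ∀ L B → WinnableWithin L B → WinnableFrom G m B
  within⇒winnable zero    B won                   = [] , [] , won
  within⇒winnable (suc L) B (inj₁ won)            = [] , [] , won
  within⇒winnable (suc L) B (inj₂ (F , ∣F∣≤m , w)) with within⇒winnable L (step G F B) w
  ... | s , valid , won = F ∷ s , ∣F∣≤m ∷ valid , won

  winnable⇒within : ∀ s B L → IsStrategy m s → burnFrom G s B ≡ ⊥ → length s ≤ L → WinnableWithin L B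
  winnable⇒within []      B zero    _ won _ = won
  winnable⇒within []      B (suc L) _ won _ = inj₁ won
  winnable⇒within (F ∷ s) B (suc L) (∣F∣≤m ∷ valid) won (s≤s len≤L) =
    inj₂ (F , ∣F∣≤m , winnable⇒within s (step G F B) L valid won len≤L)

  winnable? : Dec (Winnable G m)
  winnable? with winnableWithin? (2 ^ n) ⊤
  ... | yes w = yes (within⇒winnable (2 ^ n) ⊤ w)
  ... | no ¬w = no λ (s , valid , won) →
    let (s′ , valid′ , won′ , unique) = prune s ⊤ valid won
        short = ≤-trans (≤-trans (n≤1+n _) (≤-reflexive (sym (length-trajectory s′ ⊤))))
                        (unique-subsets-length unique)
    in ¬w (winnable⇒within s′ ⊤ (2 ^ n) valid′ won′ short)

least-winning : ∀ {n} (G : Graph n) K → Winnable G (suc K) → ∃ (IsFfn G)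
least-winning G zero    w = 1 , ≤-refl , w , λ _ 1≤m′ m′<1 _ → <⇒≱ m′<1 1≤m′
least-winning G (suc K) w with winnable? G (suc K)
... | yes w′ = least-winning G K w′
... | no  ¬w = suc (suc K) , s≤s z≤n , w , λ _ _ m′<m w′ → ¬w (winnable-mono G (≤-pred m′<m) w′)

ffn-exists : ∀ {n} (G : Graph (suc n)) → ∃ (IsFfn G)
ffn-exists {n} G = least-winning G n (winnable-by-all G)

unwinnable⇒ffn> : ∀ {n} {G : Graph n} {m} k → IsFfn G m → (∀ m′ → m′ ≤ k → ¬ Winnable G m′) → k < m
unwinnable⇒ffn> {m = m} k (_ , w , _) unwinnable with m ≤? k
... | yes m≤k = ⊥-elim (unwinnable m m≤k w)
... | no  m≰k = ≰⇒> m≰k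

regular-unwinnable : ∀ {n d m} (G : Graph (suc n)) → Regular d G → m ≤ d → ¬ Winnable G m
regular-unwinnable G regular m≤d = mindeg-unwinnable G (λ v → subst (_ ≤_) (sym (regular v)) m≤d)

regular-ffn : ∀ {n d} (G : Graph (suc n)) → Regular d G → Winnable G (suc d) → IsFfn G (suc d)
regular-ffn G regular w = s≤s z≤n , w , λ _ _ m′<d+1 → regular-unwinnable G regular (≤-pred m′<d+1)

-- Maximum degree at most 2

module _ {n} (G : Graph n) where

  ∂ : Subset n → Subset n
  ∂ B = N G (∁ B)

  ∈∂⁺ : ∀ {B v u} → v ∈ B → u ∉ B → u ∈ nbhd G v → v ∈ ∂ B
  ∈∂⁺ v∈B u∉B = ∈N⁺ G (x∈p⇒x∉∁p v∈B) (x∉p⇒x∈∁p u∉B)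

  ∈∂⁻ : ∀ {B v} → v ∈ ∂ B → v ∈ B × ∃ λ u → u ∉ B × u ∈ nbhd G v
  ∈∂⁻ {B} v∈∂B with ∈N⁻ G {W = ∁ B} v∈∂B
  ... | v∉∁B , u , u∈∁B , u∼v = x∉∁p⇒x∈p v∉∁B , u , x∈∁p⇒x∉p u∈∁B , u∼v

  step-⊆ : ∀ {F B} → ∂ B ⊆ F → step G F B ⊆ B
  step-⊆ {F} {B} ∂B⊆F {v} v∈step with ∈step⁻ G v∈step | v ∈? B
  ... | inj₁ v∈X             | _       = proj₁ (x∈p─q⁻ B F v∈X)
  ... | inj₂ _               | yes v∈B = v∈B
  ... | inj₂ (w , w∈X , w∼v) | no  v∉B with x∈p─q⁻ B F w∈X
  ...   | w∈B , w∉F = ⊥-elim (w∉F (∂B⊆F (∈∂⁺ w∈B v∉B (nbhd-sym G w∼v))))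

  ∂-step-⊆ : ∀ {F B} → ∂ B ⊆ F → ∂ (step G F B) ⊆ F
  ∂-step-⊆ {F} {B} ∂B⊆F {v} v∈∂B′ with v ∈? F | ∈∂⁻ {B = step G F B} v∈∂B′
  ... | yes v∈F | _                     = v∈F
  ... | no  v∉F | v∈B′ , u , u∉B′ , u∼v = ⊥-elim (u∉B′
    (∈step-spread G (x∈p∧x∉q⇒x∈p─q (step-⊆ ∂B⊆F v∈B′) v∉F) (nbhd-sym G u∼v)))

  extinguished : ∀ {F B a} → a ∈ F → nbhd G a ∩ B ⊆ F → a ∉ step G F B
  extinguished {F} {B} a∈F nbhd∩B⊆F a∈step with ∈step⁻ G a∈step
  ... | inj₁ a∈X = proj₂ (x∈p─q⁻ B F a∈X) a∈F
  ... | inj₂ (w , w∈X , w∼a) with x∈p─q⁻ B F w∈X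
  ...   | w∈B , w∉F = w∉F (nbhd∩B⊆F (x∈p∩q⁺ (w∼a , w∈B)))

  protect-round : ∀ {F B a} → ∂ B ⊆ F → a ∈ B → a ∈ F → nbhd G a ∩ B ⊆ F →
    ∣ step G F B ∣ < ∣ B ∣ × ∣ ∂ (step G F B) ∣ < ∣ F ∣
  protect-round {F} {B} {a} ∂B⊆F a∈B a∈F nbhd∩B⊆F =
      p⊂q⇒∣p∣<∣q∣ (step-⊆ ∂B⊆F , _ , a∈B , a∉B′)
    , p⊂q⇒∣p∣<∣q∣ (∂-step-⊆ {B = B} ∂B⊆F , _ , a∈F , a∉B′ ∘ proj₁ ∘ ∈∂⁻ {B = step G F B})
    where
    a∉B′ : a ∉ step G F B
    a∉B′ = extinguished a∈F nbhd∩B⊆F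

  ∂⊤≡⊥ : ∂ ⊤ ≡ ⊥
  ∂⊤≡⊥ = Empty-unique λ (v , v∈∂⊤) → let (_ , u , u∉⊤ , _) = ∈∂⁻ v∈∂⊤ in u∉⊤ ∈⊤

  module _ {d} (d≤2 : d ≤ 2) (deg≤d : ∀ v → ∣ nbhd G v ∣ ≤ d) where

    ∂-bounded-round : ∀ {B} → ∣ ∂ B ∣ ≤ d → Nonempty B →
      ∃ λ F → ∣ F ∣ ≤ suc d × ∣ ∂ (step G F B) ∣ ≤ d × ∣ step G F B ∣ < ∣ B ∣
    ∂-bounded-round {B} ∣∂B∣≤d (b , b∈B) with nonempty? (∂ B)
    ... | yes (a , a∈∂B) =
      let (∣B′∣<∣B∣ , ∣∂B′∣<∣F∣) = protect-round (q⊆p∪q _ _) (proj₁ (∈∂⁻ a∈∂B)) (q⊆p∪q _ _ a∈∂B) (p⊆p∪q _)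
      in F , ∣F∣≤1+d , ≤-pred (≤-trans ∣∂B′∣<∣F∣ ∣F∣≤1+d) , ∣B′∣<∣B∣
      where
      F : Subset n
      F = (nbhd G a ∩ B) ∪ ∂ B
      ∣burning-nbhd∣<d : ∣ nbhd G a ∩ B ∣ < d
      ∣burning-nbhd∣<d with ∈∂⁻ a∈∂B
      ... | _ , u , u∉B , u∼a = <-≤-trans (p⊂q⇒∣p∣<∣q∣ (p∩q⊆p _ _ , u , u∼a , u∉B ∘ p∩q⊆q _ _)) (deg≤d a)
      -- (d − 1) + d ≤ d + 1: the only place where d ≤ 2 is used.
      ∣F∣≤1+d : ∣ F ∣ ≤ suc d
      ∣F∣≤1+d = ≤-pred (begin-strict
        ∣ F ∣                            ≤⟨ ∣p∪q∣≤∣p∣+∣q∣ (nbhd G a ∩ B) (∂ B) ⟩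
        ∣ nbhd G a ∩ B ∣ + ∣ ∂ B ∣       <⟨ +-mono-<-≤ ∣burning-nbhd∣<d ∣∂B∣≤d ⟩
        d + d                            ≤⟨ +-monoˡ-≤ d d≤2 ⟩
        suc (suc d)                      ∎)
        where open ≤-Reasoning
    ... | no ∂B-empty =
      let (∣B′∣<∣B∣ , ∣∂B′∣<∣F∣) = protect-round (λ v∈∂B → ⊥-elim (∂B-empty (_ , v∈∂B)))
                                                b∈B (p⊆p∪q _ (x∈⁅x⁆ b)) (q⊆p∪q _ _ ∘ p∩q⊆p _ _)
      in F , ∣F∣≤1+d , ≤-pred (≤-trans ∣∂B′∣<∣F∣ ∣F∣≤1+d) , ∣B′∣<∣B∣
      where
      F : Subset n
      F = ⁅ b ⁆ ∪ nbhd G b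
      ∣F∣≤1+d : ∣ F ∣ ≤ suc d
      ∣F∣≤1+d = begin
        ∣ F ∣                        ≤⟨ ∣p∪q∣≤∣p∣+∣q∣ ⁅ b ⁆ (nbhd G b) ⟩
        ∣ ⁅ b ⁆ ∣ + ∣ nbhd G b ∣     ≡⟨ cong (_+ ∣ nbhd G b ∣) (∣⁅x⁆∣≡1 b) ⟩
        suc ∣ nbhd G b ∣             ≤⟨ s≤s (deg≤d b) ⟩
        suc d                        ∎
        where open ≤-Reasoning

    maxdeg≤2-winnable : Winnable G (suc d)
    maxdeg≤2-winnable = descent G (λ B → ∣ ∂ B ∣ ≤ d) ∂-bounded-round ∣∂⊤∣≤d
      where
      ∣∂⊤∣≤d : ∣ ∂ ⊤ ∣ ≤ d
      ∣∂⊤∣≤d rewrite ∂⊤≡⊥ | ∣⊥∣≡0 n = z≤n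

-- Isoperimetric obstruction

module _ {n} (G : Graph n) where

  -- The new unburnt set U′, its neighbourhood N U′ and the unprotected burning set B ─ F are pairwise
  -- disjoint, while B ⊆ F ∪ (B ─ F).
  unburnt-growth : ∀ F B → ∣ ∁ (step G F B) ∣ + ∣ N G (∁ (step G F B)) ∣ ≤ ∣ ∁ B ∣ + ∣ F ∣
  unburnt-growth F B = +-cancelʳ-≤ ∣ X ∣ _ _ (begin
    ∣ U′ ∣ + ∣ N G U′ ∣ + ∣ X ∣        ≡⟨ cong (_+ ∣ X ∣) (∣p∪q∣≡∣p∣+∣q∣ U′ (N G U′) U′∩NU′-empty) ⟨
    ∣ U′ ∪ N G U′ ∣ + ∣ X ∣            ≡⟨ ∣p∪q∣≡∣p∣+∣q∣ (U′ ∪ N G U′) X [U′∪NU′]∩X-empty ⟨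
    ∣ (U′ ∪ N G U′) ∪ X ∣              ≤⟨ ∣p∣≤n ((U′ ∪ N G U′) ∪ X) ⟩
    n                                  ≡⟨ trans (sym (∣p∣+∣∁p∣≡n B)) (+-comm (∣ B ∣) (∣ ∁ B ∣)) ⟩
    ∣ ∁ B ∣ + ∣ B ∣                    ≤⟨ +-monoʳ-≤ (∣ ∁ B ∣) (p⊆q⇒∣p∣≤∣q∣ B⊆F∪X) ⟩
    ∣ ∁ B ∣ + ∣ F ∪ X ∣                ≤⟨ +-monoʳ-≤ (∣ ∁ B ∣) (∣p∪q∣≤∣p∣+∣q∣ F X) ⟩
    ∣ ∁ B ∣ + (∣ F ∣ + ∣ X ∣)          ≡⟨ +-assoc (∣ ∁ B ∣) (∣ F ∣) (∣ X ∣) ⟨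
    ∣ ∁ B ∣ + ∣ F ∣ + ∣ X ∣            ∎)
    where
    open ≤-Reasoning
    X U′ : Subset n
    X  = B ─ F
    U′ = ∁ (step G F B)
    U′∩NU′-empty : Empty (U′ ∩ N G U′)
    U′∩NU′-empty (v , v∈) = proj₁ (∈N⁻ G {W = U′} (p∩q⊆q _ _ v∈)) (p∩q⊆p _ _ v∈)
    [U′∪NU′]∩X-empty : Empty ((U′ ∪ N G U′) ∩ X)
    [U′∪NU′]∩X-empty (v , v∈) with x∈p∪q⁻ U′ (N G U′) (p∩q⊆p _ _ v∈)
    ... | inj₁ v∈U′ = x∈∁p⇒x∉p v∈U′ (∈step⁺ G (p∩q⊆q _ _ v∈))
    ... | inj₂ v∈NU′ with ∈N⁻ G {W = U′} v∈NU′
    ...   | _ , u , u∈U′ , u∼v = x∈∁p⇒x∉p u∈U′ (∈step-spread G (p∩q⊆q _ _ v∈) (nbhd-sym G u∼v))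
    B⊆F∪X : B ⊆ F ∪ X
    B⊆F∪X {v} v∈B with v ∈? F
    ... | yes v∈F = p⊆p∪q X v∈F
    ... | no  v∉F = q⊆p∪q F X (x∈p∧x∉q⇒x∈p─q v∈B v∉F)

  isoperimetric-unwinnable : ∀ {s k} → s < n → (∀ U → s < ∣ U ∣ → s + k < ∣ U ∣ + ∣ N G U ∣) →
    ¬ Winnable G k
  isoperimetric-unwinnable {s} {k} s<n expands (strategy , valid , won) =
    go strategy ⊤ ∣∁⊤∣≤s valid won
    where
    ∣∁⊤∣≤s : ∣ ∁ (⊤ {n}) ∣ ≤ s
    ∣∁⊤∣≤s rewrite ∣∁p∣≡n∸∣p∣ (⊤ {n}) | ∣⊤∣≡n n | n∸n≡0 n = z≤n
    ∣∁⊥∣≡n : ∣ ∁ (⊥ {n}) ∣ ≡ n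
    ∣∁⊥∣≡n rewrite ∣∁p∣≡n∸∣p∣ (⊥ {n}) | ∣⊥∣≡0 n = refl
    go : ∀ strategy B → ∣ ∁ B ∣ ≤ s → IsStrategy k strategy → burnFrom G strategy B ≢ ⊥
    go []             B ∣∁B∣≤s _ refl = <⇒≱ s<n (subst (_≤ s) ∣∁⊥∣≡n ∣∁B∣≤s)
    go (F ∷ strategy) B ∣∁B∣≤s (∣F∣≤k ∷ valid) won with s <? ∣ ∁ (step G F B) ∣
    ... | no  ∣∁B′∣≯s = go strategy (step G F B) (≮⇒≥ ∣∁B′∣≯s) valid won
    ... | yes ∣∁B′∣>s =
      <⇒≱ (expands (∁ (step G F B)) ∣∁B′∣>s) (≤-trans (unburnt-growth F B) (+-mono-≤ ∣∁B∣≤s ∣F∣≤k))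

-- Complete graphs, products and cycles

_==_ : ∀ {n} → Fin n → Fin n → Bool
i == j = does (i Data.Fin.≟ j)

==-refl : ∀ {n} (i : Fin n) → (i == i) ≡ true
==-refl i = dec-true (i Data.Fin.≟ i) refl

==-≢ : ∀ {n} {i j : Fin n} → i ≢ j → (i == j) ≡ false
==-≢ {i = i} {j} = dec-false (i Data.Fin.≟ j)

==-sym : ∀ {n} (i j : Fin n) → (i == j) ≡ (j == i)
==-sym i j with i Data.Fin.≟ j
... | yes refl = sym (==-refl i)
... | no  i≢j  = sym (==-≢ (i≢j ∘ sym))

==-∧-cong : ∀ {n} (i j : Fin n) {b c : Bool} → (i ≡ j → b ≡ c) → (i == j) ∧ b ≡ (i == j) ∧ c
==-∧-cong i j b≡c with i Data.Fin.≟ j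
... | yes i≡j = b≡c i≡j
... | no  _   = refl

∑-count-select : ∀ {a b} (x : Fin a) (p : Fin a → Fin b → Bool) →
  ∑[ x′ < a ] count (λ y′ → (x == x′) ∧ p x′ y′) ≡ count (p x)
∑-count-select x p = trans
  (∑-single _ x λ x′ x′≢x → count-none _ λ y′ → cong (_∧ p x′ y′) (==-≢ (x′≢x ∘ sym)))
  (count-cong λ y′ → cong (_∧ p x y′) (==-refl x))

complete : ∀ n → Graph n
complete n = record
  { adj    = λ i j → not (i == j)
  ; sym    = λ i j → cong not (==-sym i j)
  ; irrefl = λ i → cong not (==-refl i)
  }

complete-regular : ∀ d → Regular d (complete (suc d))
complete-regular d v = +-cancelˡ-≡ 1 _ _ (begin
  1 + ∣ nbhd (complete (suc d)) v ∣          ≡⟨ cong₂ _+_ only-v (∣tabulate∣≡count (not ∘ (v ==_))) ⟩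
  count (v ==_) + count (not ∘ (v ==_))      ≡⟨ count+count-not (v ==_) ⟩
  suc d                                      ∎)
  where
  open ≡-Reasoning
  only-v : 1 ≡ count (v ==_)
  only-v = sym (count-single (v ==_) v (==-refl v) (λ _ → ==-≢ ∘ (_∘ sym)))

module _ {a b} (H : Fin a → Graph b) (K : Fin b → Graph a) where

  productAdj : Fin a × Fin b → Fin a × Fin b → Bool
  productAdj (x , y) (x′ , y′) = ((x == x′) ∧ adj (H x) y y′) ∨ ((y == y′) ∧ adj (K y) x x′)

  productAdj-sym : ∀ p q → productAdj p q ≡ productAdj q p
  productAdj-sym (x , y) (x′ , y′) = cong₂ _∨_
    (trans (==-∧-cong x x′ λ { refl → Graph.sym (H x) y y′ }) (cong (_∧ adj (H x′) y′ y) (==-sym x x′)))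
    (trans (==-∧-cong y y′ λ { refl → Graph.sym (K y) x x′ }) (cong (_∧ adj (K y′) x′ x) (==-sym y y′)))

  productAdj-irrefl : ∀ p → productAdj p p ≡ false
  productAdj-irrefl (x , y) rewrite ==-refl x | ==-refl y | irrefl (H x) y | irrefl (K y) x = refl

  product : Graph (a * b)
  product = record
    { adj    = λ v w → productAdj (remQuot b v) (remQuot b w)
    ; sym    = λ v w → productAdj-sym (remQuot b v) (remQuot b w)
    ; irrefl = λ v → productAdj-irrefl (remQuot b v)
    }

  product-adj : ∀ x y x′ y′ → adj product (combine x y) (combine x′ y′) ≡ productAdj (x , y) (x′ , y′)
  product-adj x y x′ y′ = cong₂ productAdj (remQuot-combine x y) (remQuot-combine x′ y′)

  product-edgeᴴ : ∀ {x y y′} → y′ ∈ nbhd (H x) y → combine x y′ ∈ nbhd product (combine x y)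
  product-edgeᴴ {x} {y} {y′} y′∼y = ∈nbhd⁺ product (begin
    adj product (combine x y) (combine x y′)
      ≡⟨ product-adj x y x y′ ⟩
    ((x == x) ∧ adj (H x) y y′) ∨ ((y == y′) ∧ adj (K y) x x)
      ≡⟨ cong (λ c → (c ∧ adj (H x) y y′) ∨ _) (==-refl x) ⟩
    adj (H x) y y′ ∨ ((y == y′) ∧ adj (K y) x x)
      ≡⟨ cong (_∨ _) (∈nbhd⁻ (H x) y′∼y) ⟩
    true ∎)
    where open ≡-Reasoning

  product-edgeᴷ : ∀ {x x′ y} → x′ ∈ nbhd (K y) x → combine x′ y ∈ nbhd product (combine x y)
  product-edgeᴷ {x} {x′} {y} x′∼x = ∈nbhd⁺ product (begin
    adj product (combine x y) (combine x′ y)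
      ≡⟨ product-adj x y x′ y ⟩
    ((x == x′) ∧ adj (H x) y y) ∨ ((y == y) ∧ adj (K y) x x′)
      ≡⟨ cong (λ c → _ ∨ (c ∧ adj (K y) x x′)) (==-refl y) ⟩
    ((x == x′) ∧ adj (H x) y y) ∨ adj (K y) x x′
      ≡⟨ cong (_ ∨_) (∈nbhd⁻ (K y) x′∼x) ⟩
    ((x == x′) ∧ adj (H x) y y) ∨ true
      ≡⟨ ∨-zeroʳ _ ⟩
    true ∎)
    where open ≡-Reasoning

  product-degree : ∀ x y → ∣ nbhd product (combine x y) ∣ ≡ ∣ nbhd (H x) y ∣ + ∣ nbhd (K y) x ∣
  product-degree x y = begin
    ∣ nbhd product (combine x y) ∣
      ≡⟨ ∣tabulate∣≡count (adj product (combine x y)) ⟩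
    count (adj product (combine x y))
      ≡⟨ ∑-combine a b _ ⟩
    ∑[ x′ < a ] ∑[ y′ < b ] 𝟙 (adj product (combine x y) (combine x′ y′))
      ≡⟨ sum-cong-≗ (λ x′ → sum-cong-≗ λ y′ →
           trans (cong 𝟙 (product-adj x y x′ y′)) (𝟙-∨-disjoint (inH x′ y′) (inK x′ y′) (disjoint x′ y′))) ⟩
    ∑[ x′ < a ] ∑[ y′ < b ] (𝟙 (inH x′ y′) + 𝟙 (inK x′ y′))
      ≡⟨ sum-cong-≗ (λ x′ → ∑-distrib-+ (𝟙 ∘ inH x′) (𝟙 ∘ inK x′)) ⟩
    ∑[ x′ < a ] (count (inH x′) + count (inK x′))
      ≡⟨ ∑-distrib-+ (count ∘ inH) (count ∘ inK) ⟩
    ∑[ x′ < a ] count (inH x′) + ∑[ x′ < a ] ∑[ y′ < b ] 𝟙 (inK x′ y′)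
      ≡⟨ cong (∑[ x′ < a ] count (inH x′) +_) (∑-comm (λ x′ y′ → 𝟙 (inK x′ y′))) ⟩
    ∑[ x′ < a ] count (inH x′) + ∑[ y′ < b ] ∑[ x′ < a ] 𝟙 (inK x′ y′)
      ≡⟨ cong₂ _+_ (∑-count-select x λ _ → adj (H x) y) (∑-count-select y λ _ → adj (K y) x) ⟩
    count (adj (H x) y) + count (adj (K y) x)
      ≡⟨ cong₂ _+_ (∣tabulate∣≡count (adj (H x) y)) (∣tabulate∣≡count (adj (K y) x)) ⟨
    ∣ nbhd (H x) y ∣ + ∣ nbhd (K y) x ∣
      ∎
    where
    open ≡-Reasoning
    inH : Fin a → Fin b → Bool
    inH x′ y′ = (x == x′) ∧ adj (H x) y y′
    inK : Fin a → Fin b → Bool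
    inK x′ y′ = (y == y′) ∧ adj (K y) x x′
    disjoint : ∀ x′ y′ → inH x′ y′ ∧ inK x′ y′ ≡ false
    disjoint x′ y′ = begin
      ((x == x′) ∧ adj (H x) y y′) ∧ inK x′ y′     ≡⟨ ∧-assoc (x == x′) _ _ ⟩
      (x == x′) ∧ (adj (H x) y y′ ∧ inK x′ y′)     ≡⟨ ==-∧-cong x x′ (λ { refl → kill }) ⟩
      (x == x′) ∧ false                            ≡⟨ ∧-zeroʳ _ ⟩
      false                                        ∎
      where
      kill : adj (H x) y y′ ∧ ((y == y′) ∧ adj (K y) x x) ≡ false
      kill rewrite irrefl (K y) x | ∧-zeroʳ (y == y′) = ∧-zeroʳ _

  product-regular : ∀ {d} → (∀ x y → ∣ nbhd (H x) y ∣ + ∣ nbhd (K y) x ∣ ≡ d) → Regular d product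
  product-regular {d} degrees v =
    subst (λ v → ∣ nbhd product v ∣ ≡ d) (combine-remQuot {a} b v) (trans (product-degree _ _) (degrees _ _))

empty : ∀ n → Graph n
empty n = record { adj = λ _ _ → false ; sym = λ _ _ → refl ; irrefl = λ _ → refl }

empty-degree : ∀ {n} v → ∣ nbhd (empty n) v ∣ ≡ 0
empty-degree {n} v = trans (∣tabulate∣≡count (adj (empty n) v)) (count-none {n} _ λ _ → refl)

prev : ∀ {M} → Fin (suc M) → Fin (suc M)
prev {M} zero    = fromℕ M
prev     (suc i) = inject₁ i

prev-injective : ∀ {M} {i j : Fin (suc M)} → prev i ≡ prev j → i ≡ j
prev-injective {i = zero}  {zero}  _  = refl
prev-injective {i = zero}  {suc j} eq = ⊥-elim (fromℕ≢inject₁ eq)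
prev-injective {i = suc i} {zero}  eq = ⊥-elim (fromℕ≢inject₁ (sym eq))
prev-injective {i = suc i} {suc j} eq = cong suc (inject₁-injective eq)

prev-surjective : ∀ {M} (i : Fin (suc M)) → ∃ λ j → prev j ≡ i
prev-surjective {zero}  zero    = zero , refl
prev-surjective {suc M} zero    = suc zero , refl
prev-surjective {suc M} (suc i) with prev-surjective i
... | zero  , prev≡i = zero , cong suc prev≡i
... | suc j , prev≡i = suc (suc j) , cong suc prev≡i

prev-≢ : ∀ {M} (i : Fin (suc (suc M))) → i ≢ prev i
prev-≢ (suc i) eq = 1+n≢n (trans (cong toℕ eq) (toℕ-inject₁ i))

prev²-≢ : ∀ {M} (i : Fin (suc (suc (suc M)))) → i ≢ prev (prev i)
prev²-≢ {M} zero eq = 0≢1+n (trans (cong toℕ eq) (trans (toℕ-inject₁ (fromℕ (suc M))) (toℕ-fromℕ (suc M))))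
prev²-≢ (suc (suc i)) eq =
  m≢1+n+m (toℕ i) (sym (trans (cong toℕ eq) (trans (toℕ-inject₁ (inject₁ i)) (toℕ-inject₁ i))))

cycle : ∀ M → Graph (suc (suc (suc M)))
cycle M = record
  { adj    = λ i j → (j == prev i) ∨ (i == prev j)
  ; sym    = λ i j → ∨-comm (j == prev i) (i == prev j)
  ; irrefl = λ i → cong (λ c → c ∨ c) (==-≢ (prev-≢ i))
  }

cycle-degree : ∀ M i → ∣ nbhd (cycle M) i ∣ ≡ 2
cycle-degree M i = begin
  ∣ nbhd (cycle M) i ∣
    ≡⟨ ∣tabulate∣≡count (adj (cycle M) i) ⟩
  count (λ j → (j == prev i) ∨ (i == prev j))
    ≡⟨ count-∨-disjoint (_== prev i) (λ j → i == prev j) not-both ⟩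
  count (_== prev i) + count (λ j → i == prev j)
    ≡⟨ cong₂ _+_ one-predecessor one-successor ⟩
  2 ∎
  where
  open ≡-Reasoning
  not-both : ∀ j → (j == prev i) ∧ (i == prev j) ≡ false
  not-both j = trans (==-∧-cong j (prev i) λ { refl → ==-≢ (prev²-≢ i) }) (∧-zeroʳ _)
  one-predecessor : count (_== prev i) ≡ 1
  one-predecessor = count-single _ (prev i) (==-refl (prev i)) (λ _ → ==-≢)
  one-successor : count (λ j → i == prev j) ≡ 1
  one-successor with prev-surjective i
  ... | j₀ , prev-j₀≡i = count-single _ j₀ (trans (cong (i ==_) prev-j₀≡i) (==-refl i))
    λ j j≢j₀ → ==-≢ λ i≡prev-j → j≢j₀ (prev-injective (trans (sym i≡prev-j) (sym prev-j₀≡i)))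

cycle-edge : ∀ {M} (k : Fin (suc (suc M))) → inject₁ k ∈ nbhd (cycle M) (suc k)
cycle-edge {M} k = ∈nbhd⁺ (cycle M) {suc k} (cong (_∨ (suc k == prev (inject₁ k))) (==-refl (inject₁ k)))

-- Thick tori

crossing : ∀ {M} {P : Fin (suc M) → Set} → (∀ i → Dec (P i)) → ∀ {i j} → P i → ¬ P j →
  ∃ λ k → (P (inject₁ k) × ¬ P (suc k)) ⊎ (¬ P (inject₁ k) × P (suc k))
crossing {zero}  P? {zero} {zero} Pi ¬Pj = ⊥-elim (¬Pj Pi)
crossing {suc M} P? {i} {j} Pi ¬Pj with P? zero | P? (suc zero) | i | j
... | yes P0 | no ¬P1 | _      | _      = zero , inj₁ (P0 , ¬P1)
... | no ¬P0 | yes P1 | _      | _      = zero , inj₂ (¬P0 , P1)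
... | yes P0 | yes _  | _      | zero   = ⊥-elim (¬Pj P0)
... | yes _  | yes P1 | _      | suc _  = map suc id (crossing (P? ∘ suc) P1 ¬Pj)
... | no ¬P0 | no _   | zero   | _      = ⊥-elim (¬P0 Pi)
... | no _   | no ¬P1 | suc _  | _      = map suc id (crossing (P? ∘ suc) Pi ¬P1)

module _ {n} (G : Graph n) {M c} (h : Fin (suc M) → Fin c → Fin n) (a₀ : Fin c)
         (spine : ∀ k → h (inject₁ k) a₀ ∈ nbhd G (h (suc k) a₀))
         (tooth : ∀ i a → a ≢ a₀ → h i a ∈ nbhd G (h i a₀)) where

  comb-∂ : ∀ {U i a i′ a′} → h i a ∈ U → h i′ a′ ∉ U → ∃ λ i″ → ∃ λ a″ → h i″ a″ ∈ N G U
  comb-∂ {U} {i} {a} {i′} {a′} in-U out-U with h i a₀ ∈? U | h i′ a₀ ∈? U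
  ... | no  spine-i∉U | _ = i , a₀ , ∈N⁺ G spine-i∉U in-U (tooth i a λ { refl → spine-i∉U in-U })
  ... | yes _ | yes spine-i′∈U =
    i′ , a′ , ∈N⁺ G out-U spine-i′∈U (nbhd-sym G (tooth i′ a′ λ { refl → out-U spine-i′∈U }))
  ... | yes spine-i∈U | no spine-i′∉U with crossing (λ i → h i a₀ ∈? U) spine-i∈U spine-i′∉U
  ...   | k , inj₁ (inside , outside) = suc k , a₀ , ∈N⁺ G outside inside (spine k)
  ...   | k , inj₂ (outside , inside) = inject₁ k , a₀ , ∈N⁺ G outside inside (nbhd-sym G (spine k))

-- V j i a is the vertex in row j, column i and layer a. The c layers at (j , i) form a clique, layer 0
-- carries the cycles along the rows and every other layer the cycles along the columns, so every vertex
-- has degree (c − 1) + 2.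
module Grid (M l : ℕ) where

  side : ℕ
  side = suc (suc (suc M))

  c : ℕ
  c = suc (suc l)

  K : ℕ
  K = side * c

  layerᴴ : Fin c → Graph side
  layerᴴ zero    = cycle M
  layerᴴ (suc _) = empty side

  layerⱽ : Fin c → Graph side
  layerⱽ zero    = empty side
  layerⱽ (suc _) = cycle M

  thickCycle : Graph K
  thickCycle = product (λ _ → complete c) layerᴴ

  layer : Fin K → Fin c
  layer y = proj₂ (remQuot {side} c y)

  layer-combine : ∀ i a → layer (combine i a) ≡ a
  layer-combine i a = cong proj₂ (remQuot-combine {side} {c} i a)

  grid : Graph (side * K)
  grid = product (λ _ → thickCycle) (layerⱽ ∘ layer)

  V : Fin side → Fin side → Fin c → Fin (side * K)
  V j i a = combine j (combine i a)

  grid-regular : Regular (suc (suc (suc l))) grid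
  grid-regular = product-regular (λ _ → thickCycle) (layerⱽ ∘ layer) degrees
    where
    layers-degree : ∀ a i j → ∣ nbhd (layerᴴ a) i ∣ + ∣ nbhd (layerⱽ a) j ∣ ≡ 2
    layers-degree zero    i j = cong₂ _+_ (cycle-degree M i) (empty-degree j)
    layers-degree (suc _) i j = cong₂ _+_ (empty-degree i) (cycle-degree M j)
    degrees : ∀ j y → ∣ nbhd thickCycle y ∣ + ∣ nbhd (layerⱽ (layer y)) j ∣ ≡ suc (suc (suc l))
    degrees j = combine-elim side c λ i a → begin
      ∣ nbhd thickCycle (combine i a) ∣ + ∣ nbhd (layerⱽ (layer (combine i a))) j ∣
        ≡⟨ cong₂ _+_ (product-degree (λ _ → complete c) layerᴴ i a)
                     (cong (λ a → ∣ nbhd (layerⱽ a) j ∣) (layer-combine i a)) ⟩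
      ∣ nbhd (complete c) a ∣ + ∣ nbhd (layerᴴ a) i ∣ + ∣ nbhd (layerⱽ a) j ∣
        ≡⟨ +-assoc (∣ nbhd (complete c) a ∣) _ _ ⟩
      ∣ nbhd (complete c) a ∣ + (∣ nbhd (layerᴴ a) i ∣ + ∣ nbhd (layerⱽ a) j ∣)
        ≡⟨ cong₂ _+_ (complete-regular (suc l) a) (layers-degree a i j) ⟩
      suc l + 2
        ≡⟨ +-comm (suc l) 2 ⟩
      suc (suc (suc l))
        ∎
      where open ≡-Reasoning

  fibre-edge : ∀ {j i a a′} → a ≢ a′ → V j i a′ ∈ nbhd grid (V j i a)
  fibre-edge {j} {i} {a} {a′} a≢a′ = product-edgeᴴ (λ _ → thickCycle) (layerⱽ ∘ layer) {x = j}
    (product-edgeᴴ (λ _ → complete c) layerᴴ {x = i} (∈nbhd⁺ (complete c) {a} (cong not (==-≢ a≢a′))))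

  row-edge : ∀ {j} k → V j (inject₁ k) zero ∈ nbhd grid (V j (suc k) zero)
  row-edge {j} k = product-edgeᴴ (λ _ → thickCycle) (layerⱽ ∘ layer) {x = j}
    (product-edgeᴷ (λ _ → complete c) layerᴴ {suc k} {inject₁ k} {zero} (cycle-edge {M} k))

  column-edge : ∀ {i} k → V (inject₁ k) i (suc zero) ∈ nbhd grid (V (suc k) i (suc zero))
  column-edge {i} k =
    product-edgeᴷ (λ _ → thickCycle) (layerⱽ ∘ layer) {suc k} {inject₁ k} {combine i (suc zero)} (subst (λ a → inject₁ k ∈ nbhd (layerⱽ a) (suc k)) (sym (layer-combine i (suc zero))) (cycle-edge {M} k))

  row-∂ : ∀ {U} (j : Fin side) (y y′ : Fin K) → combine j y ∈ U → combine j y′ ∉ U →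
    ∃ λ (y″ : Fin K) → combine j y″ ∈ N grid U
  row-∂ {U} j = combine-elim side c λ i a → combine-elim side c λ i′ a′ inside outside →
    let (i″ , a″ , i″a″∈∂) = comb-∂ grid (V j) zero (row-edge {j}) (λ i a a≢0 → fibre-edge {j} {i} {zero} (a≢0 ∘ sym))
                                    {U} {i} {a} {i′} {a′} inside outside
    in combine i″ a″ , i″a″∈∂

  column-∂ : ∀ {U} i j a j′ a′ → V j i a ∈ U → V j′ i a′ ∉ U → ∃ λ j″ → ∃ λ a″ → V j″ i a″ ∈ N grid U
  column-∂ {U} i j a j′ a′ =
    comb-∂ grid (λ j a → V j i a) (suc zero) (column-edge {i}) (λ j a a≢1 → fibre-edge {j} {i} {suc zero} (a≢1 ∘ sym))
           {U} {j} {a} {j′} {a′}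

  rowOf : (Fin (side * K) → Bool) → Fin side → Fin K → Bool
  rowOf p j y = p (combine j y)

  count-rows : ∀ p → count p ≡ ∑[ j < side ] count (rowOf p j)
  count-rows p = ∑-combine side K (𝟙 ∘ p)

  rows-bound : ∀ U (p : Fin (side * K) → Bool) →
    (∀ j → ∃ (λ y → rowOf p j y ≡ true) → ∃ λ y → combine j y ∈ N grid U) → count p ≤ K * ∣ N grid U ∣
  rows-bound U p row-∂U = begin
    count p                                     ≡⟨ count-rows p ⟩
    ∑[ j < side ] count (rowOf p j)             ≤⟨ ∑-count-≤ (rowOf p) (rowOf ∂U) row-∂U′ ⟩
    K * ∑[ j < side ] count (rowOf ∂U j)        ≡⟨ cong (K *_) (count-rows ∂U) ⟨
    K * count ∂U                                ≡⟨ cong (K *_) (∣p∣≡count (N grid U)) ⟨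
    K * ∣ N grid U ∣                            ∎
    where
    open ≤-Reasoning
    ∂U : Fin (side * K) → Bool
    ∂U = lookup (N grid U)
    row-∂U′ : ∀ j → ∃ (λ y → rowOf p j y ≡ true) → ∃ λ y → rowOf ∂U j y ≡ true
    row-∂U′ j p-somewhere = let (y , y∈∂U) = row-∂U j p-somewhere in y , []=⇒lookup y∈∂U

  columns-bound : ∀ U → (∀ i → ∃ λ j → ∃ λ a → V j i a ∈ N grid U) → side ≤ ∣ N grid U ∣
  columns-bound U column-∂U = begin
    side                                                     ≡⟨ *-identityʳ side ⟨
    side * 1                                                 ≡⟨ ∑-const side 1 ⟨
    ∑[ i < side ] 1                                          ≤⟨ ∑-mono-≤ column-hit ⟩
    ∑[ i < side ] ∑[ j < side ] ∑[ a < c ] 𝟙 (∂U (V j i a))  ≡⟨ ∑-comm (λ j i → ∑[ a < c ] 𝟙 (∂U (V j i a))) ⟨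
    ∑[ j < side ] ∑[ i < side ] ∑[ a < c ] 𝟙 (∂U (V j i a))  ≡⟨ sum-cong-≗ (∑-combine side c ∘ row-𝟙) ⟨
    ∑[ j < side ] count (rowOf ∂U j)                         ≡⟨ count-rows ∂U ⟨
    count ∂U                                                 ≡⟨ ∣p∣≡count (N grid U) ⟨
    ∣ N grid U ∣                                             ∎
    where
    open ≤-Reasoning
    ∂U : Fin (side * K) → Bool
    ∂U = lookup (N grid U)
    row-𝟙 : Fin side → Fin K → ℕ
    row-𝟙 j = 𝟙 ∘ rowOf ∂U j
    column-hit : ∀ i → 1 ≤ ∑[ j < side ] ∑[ a < c ] 𝟙 (∂U (V j i a))
    column-hit i = let (j , a , V∈∂U) = column-∂U i in begin
      1                                           ≡⟨ cong 𝟙 ([]=⇒lookup V∈∂U) ⟨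
      𝟙 (∂U (V j i a))                            ≤⟨ ≤-∑ (λ a → 𝟙 (∂U (V j i a))) a ⟩
      ∑[ a < c ] 𝟙 (∂U (V j i a))                 ≤⟨ ≤-∑ (λ j → ∑[ a < c ] 𝟙 (∂U (V j i a))) j ⟩
      ∑[ j < side ] ∑[ a < c ] 𝟙 (∂U (V j i a))   ∎

  -- With a full and an empty row every column meets U and its complement; otherwise every row meeting
  -- U, or every row meeting ∁ U, meets both. Each such row or column contains a vertex of N U.
  grid-isoperimetry : ∀ U → side ≤ ∣ N grid U ∣ ⊎ ∣ U ∣ ≤ K * ∣ N grid U ∣ ⊎ ∣ ∁ U ∣ ≤ K * ∣ N grid U ∣
  grid-isoperimetry U = case full-row? ,′ empty-row? of λ where
      (yes (j₁ , full) , yes (j₀ , empty)) →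
        inj₁ (columns-bound U λ i → column-∂ i j₁ zero j₀ zero (full (V₀ i)) (empty (V₀ i)))
      (no no-full , _) → inj₂ (inj₁ (begin
        ∣ U ∣                     ≡⟨ ∣p∣≡count U ⟩
        count (lookup U)          ≤⟨ rows-bound U (lookup U) (partial-row₁ no-full) ⟩
        K * ∣ N grid U ∣          ∎))
      (yes _ , no no-empty) → inj₂ (inj₂ (begin
        ∣ ∁ U ∣                   ≡⟨ trans (∣p∣≡count (∁ U)) (count-cong λ v → lookup-map v not U) ⟩
        count (not ∘ lookup U)    ≤⟨ rows-bound U (not ∘ lookup U) (partial-row₀ no-empty) ⟩
        K * ∣ N grid U ∣          ∎))
    where
    open ≤-Reasoning
    FullRow EmptyRow : Fin side → Set
    FullRow  j = ∀ y → combine j y ∈ U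
    EmptyRow j = ∀ y → combine j y ∉ U
    V₀ : Fin side → Fin K
    V₀ i = combine {side} {c} i zero
    full-row? : Dec (∃ FullRow)
    full-row? = any? λ j → all? λ y → combine j y ∈? U
    empty-row? : Dec (∃ EmptyRow)
    empty-row? = any? λ j → all? λ y → ¬? (combine j y ∈? U)
    partial-row₁ : ¬ ∃ FullRow →
      ∀ j → ∃ (λ y → rowOf (lookup U) j y ≡ true) → ∃ λ y → combine j y ∈ N grid U
    partial-row₁ no-full j (y , y∈U) =
      let (y′ , y′∉U) = ¬∀⟶∃¬ K _ (λ y → combine j y ∈? U) (λ full → no-full (j , full))
      in row-∂ j y y′ (lookup⇒∈ y∈U) y′∉U
    partial-row₀ : ¬ ∃ EmptyRow →
      ∀ j → ∃ (λ y → rowOf (not ∘ lookup U) j y ≡ true) → ∃ λ y → combine j y ∈ N grid U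
    partial-row₀ no-empty j (y , y∉U) =
      let (y′ , ¬y′∉U) = ¬∀⟶∃¬ K _ (λ y → ¬? (combine j y ∈? U)) (λ empty → no-empty (j , empty))
      in row-∂ j y′ y (decidable-stable (combine j y′ ∈? U) ¬y′∉U) (lookup⇒∉ (not-injective y∉U))

module _ (k l : ℕ) where

  open Grid (k + k) l

  k<side : k < side
  k<side = s≤s (≤-trans (m≤m+n k k) (≤-trans (n≤1+n (k + k)) (n≤1+n (suc (k + k)))))

  k<K : k < K
  k<K = <-≤-trans k<side (m≤m*n side c)

  grid-expands : ∀ U → K * k < ∣ U ∣ → K * k + k < ∣ U ∣ + ∣ N grid U ∣
  grid-expands U large = ≰⇒> λ small → let β<k = ∂-small small in case grid-isoperimetry U of λ where
      (inj₁ side≤β)           → <-asym k<side (≤-<-trans side≤β β<k)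
      (inj₂ (inj₁ ∣U∣≤Kβ))     → <-asym β<k (*-cancelˡ-< K k _ (<-≤-trans large ∣U∣≤Kβ))
      (inj₂ (inj₂ ∣∁U∣≤Kβ))    → <⇒≱ (too-big small β<k) (begin
        side * K                   ≡⟨ ∣p∣+∣∁p∣≡n U ⟨
        ∣ U ∣ + ∣ ∁ U ∣            ≤⟨ +-monoʳ-≤ (∣ U ∣) ∣∁U∣≤Kβ ⟩
        ∣ U ∣ + K * ∣ N grid U ∣   ∎)
    where
    open ≤-Reasoning
    ∂-small : ∣ U ∣ + ∣ N grid U ∣ ≤ K * k + k → ∣ N grid U ∣ < k
    ∂-small small = +-cancelˡ-< (K * k) _ _ (begin-strict
      K * k + ∣ N grid U ∣   <⟨ +-monoˡ-< (∣ N grid U ∣) large ⟩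
      ∣ U ∣ + ∣ N grid U ∣   ≤⟨ small ⟩
      K * k + k              ∎)
    too-big : ∣ U ∣ + ∣ N grid U ∣ ≤ K * k + k → ∣ N grid U ∣ < k → ∣ U ∣ + K * ∣ N grid U ∣ < side * K
    too-big small β<k = begin-strict
      ∣ U ∣ + K * ∣ N grid U ∣        ≤⟨ +-mono-≤ (m+n≤o⇒m≤o (∣ U ∣) small) (*-monoʳ-≤ K (<⇒≤ β<k)) ⟩
      K * k + k + K * k              <⟨ +-monoˡ-< (K * k) (+-monoʳ-< (K * k) k<K) ⟩
      K * k + K + K * k              ≤⟨ m≤m+n (K * k + K + K * k) (K + K) ⟩
      K * k + K + K * k + (K + K)    ≡⟨ solve 2 (λ k K → K :* k :+ K :+ K :* k :+ (K :+ K) := (con 3 :+ (k :+ k)) :* K)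
                                               refl k K ⟩
      side * K                       ∎
      where open +-*-Solver using (solve; _:+_; _:*_; _:=_; con)

  grid-ffn-exceeds : ∀ {m} → IsFfn grid m → k < m
  grid-ffn-exceeds ffn = unwinnable⇒ffn> k ffn λ m′ m′≤k → isoperimetric-unwinnable grid {s = K * k} s<n
    λ U large → ≤-<-trans (+-monoʳ-≤ (K * k) m′≤k) (grid-expands U large)
    where
    s<n : K * k < side * K
    s<n = <-≤-trans (*-monoʳ-< K k<side) (≤-reflexive (*-comm K side))

regular-ffn-exceeds : ∀ {n d} (G : Graph (suc n)) → Regular d G → Σ ℕ (λ m → IsFfn G m × suc d ≤ m)
regular-ffn-exceeds {d = d} G regular =
  let (m , ffn) = ffn-exists G in m , ffn , unwinnable⇒ffn> d ffn (λ _ → regular-unwinnable G regular)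

complete-ffn : ∀ d → IsFfn (complete (suc d)) (suc d)
complete-ffn d = regular-ffn (complete (suc d)) (complete-regular d) (winnable-by-all (complete (suc d)))

proposition3 :
    ((d : ℕ) → 1 ≤ d → (n : ℕ) → (G : Graph (suc n)) → Regular d G →
        Σ ℕ (λ m → IsFfn G m × suc d ≤ m))
    × ((d : ℕ) → 1 ≤ d →
        Σ ℕ (λ n → Σ (Graph (suc n)) (λ G → Regular d G × IsFfn G (suc d))))
    × ((d : ℕ) → (d ≡ 1 ⊎ d ≡ 2) → (n : ℕ) → (G : Graph (suc n)) → Regular d G →
        IsFfn G (suc d))
    × ((d : ℕ) → 3 ≤ d → (k : ℕ) →
        Σ ℕ (λ n → Σ (Graph (suc n)) (λ G → Regular d G × Σ ℕ (λ m → IsFfn G m × k < m))))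
proposition3 =
    (λ d _ n G → regular-ffn-exceeds G)
  , (λ d _ → d , complete (suc d) , complete-regular d , complete-ffn d)
  , (λ d d∈1,2 n G regular →
       regular-ffn G regular (maxdeg≤2-winnable G (d≤2 d∈1,2) (≤-reflexive ∘ regular)))
  , λ { (suc (suc (suc l))) (s≤s (s≤s (s≤s z≤n))) k →
          let open Grid (k + k) l
              (m , ffn) = ffn-exists grid
          in _ , grid , grid-regular , m , ffn , grid-ffn-exceeds k l ffn }
  where
  d≤2 : ∀ {d} → d ≡ 1 ⊎ d ≡ 2 → d ≤ 2
  d≤2 (inj₁ refl) = s≤s z≤n
  d≤2 (inj₂ refl) = ≤-refl
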